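{- Let $r\ge 1$ and let $G$ be a finite simple graph with maximum degree at most $r$. Then: (1) Two vertices $x,y$ of $G$ of degree $r$ belong to some common tight clique if and only if $N[x]=N[y]$. In particular, the relation "belonging to some common tight clique" is an equivalence relation on the set of vertices of degree $r$; the clusters of $G$ are pairwise disjoint and are exactly the equivalence classes of this relation. (2) Every edge of $G$ has an endpoint in at most two clusters. (3) If $e$ is an edge of $G$ such that $e$ (viewed as a $2$-vertex clique) is not tight (equivalently, $e$ is not contained in a cluster), then $k_t(e)\le\binom{r-2}{t-2}$ for every $t\ge 2$.
   Context: $N[v]$ denotes the closed neighbourhood of $v$. For a graph $G$ of maximum degree at most $r$, a nonempty clique $T\subseteq V(G)$ is called tight if the set $N(T)$ of common neighbours of all vertices of $T$ (vertices outside $T$ adjacent to every vertex of $T$) satisfies $|N(T)|=r+1-|T|$. A cluster is a tight clique that is maximal under inclusion among tight cliques. For an edge $e$, $k_t(e)$ is the number of cliques on exactly $t$ vertices of $G$ containing both endpoints of $e$. -}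

module Defs where

open import Data.Nat using (ℕ; zero; suc; _+_; _≤_)
open import Data.Bool using (Bool; true; false)
import Data.Bool as B
open import Data.Fin using (Fin)
open import Data.Fin.Properties using (all?)
import Data.Fin.Properties as FinP
open import Data.Fin.Subset using (Subset; _∈_; _⊆_; ∣_∣; Nonempty; ⁅_⁆; _∪_)
open import Data.Fin.Subset.Properties using (_∈?_)
open import Data.Vec using (Vec; []; _∷_; tabulate)
open import Data.List using (List; []; _∷_; _++_; map; filter; length)
open import Data.Product using (_×_; ∃)
open import Relation.Nullary using (¬_; Dec; does)
open import Relation.Nullary.Decidable using (_×-dec_; _→-dec_; ¬?)
open import Relation.Binary.PropositionalEquality using (_≡_; _≢_)

record Graph (n : ℕ) : Set where
  field
    adj    : Fin n → Fin n → Bool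
    sym    : ∀ x y → adj x y ≡ adj y x
    irrefl : ∀ x → adj x x ≡ false
open Graph public

module _ {n : ℕ} (G : Graph n) where

  Adj : Fin n → Fin n → Set
  Adj x y = adj G x y ≡ true

  nbhd : Fin n → Subset n
  nbhd x = tabulate (adj G x)

  deg : Fin n → ℕ
  deg x = ∣ nbhd x ∣

  closedNbhd : Fin n → Subset n
  closedNbhd x = ⁅ x ⁆ ∪ nbhd x

  MaxDegreeAtMost : ℕ → Set
  MaxDegreeAtMost r = ∀ x → deg x ≤ r

  IsClique : Subset n → Set
  IsClique T = ∀ x y → x ∈ T → y ∈ T → x ≢ y → Adj x y

  isClique? : (T : Subset n) → Dec (IsClique T)
  isClique? T = all? λ x → all? λ y →
    (x ∈? T) →-dec (y ∈? T) →-dec ¬? (x FinP.≟ y) →-dec (adj G x y B.≟ true)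

  commonNbhd : Subset n → Subset n
  commonNbhd T = tabulate λ v →
    does (¬? (v ∈? T) ×-dec all? (λ u → (u ∈? T) →-dec (adj G v u B.≟ true)))

  -- tight clique: nonempty clique with |N(T)| = r + 1 - |T|
  -- (stated additively: |N(T)| + |T| = r + 1)
  Tight : ℕ → Subset n → Set
  Tight r T = Nonempty T × IsClique T × (∣ commonNbhd T ∣ + ∣ T ∣ ≡ suc r)

  Cluster : ℕ → Subset n → Set
  Cluster r T = Tight r T × (∀ S → Tight r S → T ⊆ S → S ≡ T)

  CommonTight : ℕ → Fin n → Fin n → Set
  CommonTight r x y = ∃ λ T → Tight r T × x ∈ T × y ∈ T

allSubsets : (n : ℕ) → List (Subset n)
allSubsets zero = [] ∷ []
allSubsets (suc n) = map (true ∷_) (allSubsets n) ++ map (false ∷_) (allSubsets n)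

module _ {n : ℕ} (G : Graph n) where
  kt : ℕ → Fin n → Fin n → ℕ
  kt t x y = length (filter
    (λ S → (∣ S ∣ Data.Nat.≟ t) ×-dec (x ∈? S) ×-dec (y ∈? S) ×-dec isClique? G S)
    (allSubsets n))

module Submission where

-- For a clique T put
-- span T = N(T) ∪ T.  If u ∈ T then span T ⊆ N[u], hence
--   |N(T)| + |T| = |span T| ≤ |N[u]| = deg u + 1 ≤ r + 1,
-- so T is tight exactly when this chain is an equality, i.e. when every
-- u ∈ T has degree r and N[u] = span T.  Consequently all vertices of a
-- tight clique are twins (equal closed neighbourhoods); conversely a set of
-- twins of a degree-r vertex is a tight clique.  So the clusters are exactly
-- the twin classes  twinClass x = {y | N[x] = N[y]}  of degree-r vertices,
-- which gives part (1); part (2) follows because every cluster meeting an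
-- edge xy is twinClass x or twinClass y.  For part (3), a non-tight edge e
-- has |N(e)| ≤ r - 2, and every t-clique through e lies between e and
-- span e, so a general counting lemma for subsets squeezed between two sets
-- bounds k_t(e) by C(|N(e)|, t - 2) ≤ C(r - 2, t - 2).

open import Defs hiding (sym)
open import Data.Nat using (ℕ; zero; suc; _+_; _≤_; _∸_; z≤n; s≤s; _≤′_; ≤′-reflexive; ≤′-step)
open import Data.Nat.Properties
open import Data.Nat.Combinatorics using (_C_; nCk+nC[k+1]≡[n+1]C[k+1])
open import Data.Bool using (Bool; true; false)
import Data.Bool as B
open import Data.Fin using (Fin)
import Data.Fin.Properties as FinP
open import Data.Fin.Properties using (all?)
open import Data.Fin.Subset
  using (Subset; inside; outside; _∈_; _∉_; _⊆_; ⁅_⁆; _∪_; _─_; ∣_∣)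
open import Data.Fin.Subset.Properties
  using (_∈?_; x∈p∪q⁻; x∈p∪q⁺; x∈⁅x⁆; x∈⁅y⁆⇒x≡y; ∣⁅x⁆∣≡1; ∣p∣≤∣x∷p∣;
         p⊆q⇒∣p∣≤∣q∣; p⊂q⇒∣p∣<∣q∣; ⊆-antisym; drop-∷-⊆)
open import Data.Vec using ([]; _∷_; tabulate; here; there)
open import Data.Vec.Properties using (lookup⇒[]=; []=⇒lookup; lookup∘tabulate; ≡-dec)
open import Data.List using (List; []; _∷_; _++_; map; filter; length)
open import Data.List.Properties using (filter-++; filter-none; length-++; length-filter)
import Data.List.Relation.Unary.All as All
open import Data.Product using (_×_; ∃; _,_; proj₁; proj₂)
open import Data.Sum using (_⊎_; inj₁; inj₂)
open import Data.Empty using (⊥; ⊥-elim)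
open import Function using (_∘_)
open import Function.Bundles using (_⇔_; mk⇔; Equivalence)
open import Relation.Nullary using (¬_; Dec; yes; no; does; contradiction)
open import Relation.Nullary.Decidable using (_×-dec_; _→-dec_; ¬?; dec-true)
open import Relation.Unary using (Decidable)
open import Relation.Binary.PropositionalEquality
  using (_≡_; _≢_; refl; sym; trans; cong; cong₂; subst; subst₂; module ≡-Reasoning)

does-sound : ∀ {P : Set} (P? : Dec P) → does P? ≡ true → P
does-sound (yes p) _ = p

∈-tabulate⁺ : ∀ {n} (f : Fin n → Bool) {x} → f x ≡ true → x ∈ tabulate f
∈-tabulate⁺ f {x} fx = lookup⇒[]= x (tabulate f) (trans (lookup∘tabulate f x) fx)

∈-tabulate⁻ : ∀ {n} (f : Fin n → Bool) {x} → x ∈ tabulate f → f x ≡ true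
∈-tabulate⁻ f {x} x∈ = trans (sym (lookup∘tabulate f x)) ([]=⇒lookup x∈)

∈-decide⁺ : ∀ {n} {P : Fin n → Set} (P? : Decidable P) {x} →
            P x → x ∈ tabulate (λ v → does (P? v))
∈-decide⁺ P? {x} px = ∈-tabulate⁺ (λ v → does (P? v)) (dec-true (P? x) px)

∈-decide⁻ : ∀ {n} {P : Fin n → Set} (P? : Decidable P) {x} →
            x ∈ tabulate (λ v → does (P? v)) → P x
∈-decide⁻ P? {x} x∈ = does-sound (P? x) (∈-tabulate⁻ (λ v → does (P? v)) x∈)

∣∪∣-disjoint : ∀ {n} (p q : Subset n) → (∀ {z} → z ∈ p → z ∈ q → ⊥) →
               ∣ p ∪ q ∣ ≡ ∣ p ∣ + ∣ q ∣
∣∪∣-disjoint []            []            _ = refl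
∣∪∣-disjoint (inside ∷ p)  (inside ∷ q)  d = ⊥-elim (d here here)
∣∪∣-disjoint (inside ∷ p)  (outside ∷ q) d =
  cong suc (∣∪∣-disjoint p q (λ z∈p z∈q → d (there z∈p) (there z∈q)))
∣∪∣-disjoint (outside ∷ p) (inside ∷ q)  d =
  trans (cong suc (∣∪∣-disjoint p q (λ z∈p z∈q → d (there z∈p) (there z∈q))))
        (sym (+-suc ∣ p ∣ ∣ q ∣))
∣∪∣-disjoint (outside ∷ p) (outside ∷ q) d =
  ∣∪∣-disjoint p q (λ z∈p z∈q → d (there z∈p) (there z∈q))

⊆-by-size : ∀ {n} {p q : Subset n} → p ⊆ q → ∣ q ∣ ≤ ∣ p ∣ → q ⊆ p
⊆-by-size {p = p} p⊆q ∣q∣≤∣p∣ {x} x∈q with x ∈? p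
... | yes x∈p = x∈p
... | no  x∉p = contradiction (p⊂q⇒∣p∣<∣q∣ (p⊆q , x , x∈q , x∉p)) (≤⇒≯ ∣q∣≤∣p∣)

∣p∪q─q∣≤∣p∣ : ∀ {n} (p q : Subset n) → ∣ (p ∪ q) ─ q ∣ ≤ ∣ p ∣
∣p∪q─q∣≤∣p∣ []            []            = z≤n
∣p∪q─q∣≤∣p∣ (s ∷ p)       (inside ∷ q)  = ≤-trans (∣p∪q─q∣≤∣p∣ p q) (∣p∣≤∣x∷p∣ s p)
∣p∪q─q∣≤∣p∣ (inside ∷ p)  (outside ∷ q) = s≤s (∣p∪q─q∣≤∣p∣ p q)
∣p∪q─q∣≤∣p∣ (outside ∷ p) (outside ∷ q) = ∣p∪q─q∣≤∣p∣ p q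

∈pair⁻ : ∀ {n} {x y z : Fin n} → z ∈ ⁅ x ⁆ ∪ ⁅ y ⁆ → z ≡ x ⊎ z ≡ y
∈pair⁻ {x = x} {y} z∈ with x∈p∪q⁻ ⁅ x ⁆ ⁅ y ⁆ z∈
... | inj₁ z∈⁅x⁆ = inj₁ (x∈⁅y⁆⇒x≡y x z∈⁅x⁆)
... | inj₂ z∈⁅y⁆ = inj₂ (x∈⁅y⁆⇒x≡y y z∈⁅y⁆)

x∈pair : ∀ {n} (x y : Fin n) → x ∈ ⁅ x ⁆ ∪ ⁅ y ⁆
x∈pair x y = x∈p∪q⁺ (inj₁ (x∈⁅x⁆ x))

pair⊆ : ∀ {n} {x y : Fin n} {S} → x ∈ S → y ∈ S → ⁅ x ⁆ ∪ ⁅ y ⁆ ⊆ S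
pair⊆ x∈S y∈S z∈ with ∈pair⁻ z∈
... | inj₁ refl = x∈S
... | inj₂ refl = y∈S

∣pair∣ : ∀ {n} {x y : Fin n} → x ≢ y → ∣ ⁅ x ⁆ ∪ ⁅ y ⁆ ∣ ≡ 2
∣pair∣ {x = x} {y} x≢y = begin
  ∣ ⁅ x ⁆ ∪ ⁅ y ⁆ ∣     ≡⟨ ∣∪∣-disjoint ⁅ x ⁆ ⁅ y ⁆ disjoint ⟩
  ∣ ⁅ x ⁆ ∣ + ∣ ⁅ y ⁆ ∣ ≡⟨ cong₂ _+_ (∣⁅x⁆∣≡1 x) (∣⁅x⁆∣≡1 y) ⟩
  2                     ∎
  where
  open ≡-Reasoning
  disjoint : ∀ {z} → z ∈ ⁅ x ⁆ → z ∈ ⁅ y ⁆ → ⊥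
  disjoint z∈⁅x⁆ z∈⁅y⁆ = x≢y (trans (sym (x∈⁅y⁆⇒x≡y x z∈⁅x⁆)) (x∈⁅y⁆⇒x≡y y z∈⁅y⁆))

C-mono-suc : ∀ m k → m C k ≤ suc m C k
C-mono-suc m zero    = ≤-refl
C-mono-suc m (suc k) =
  subst (m C suc k ≤_) (nCk+nC[k+1]≡[n+1]C[k+1] m k) (m≤n+m (m C suc k) (m C k))

C-mono : ∀ {m m′} k → m ≤ m′ → m C k ≤ m′ C k
C-mono {m} k m≤m′ = go (≤⇒≤′ m≤m′)
  where
  go : ∀ {m′} → m ≤′ m′ → m C k ≤ m′ C k
  go (≤′-reflexive refl) = ≤-refl
  go (≤′-step m≤′m′) = ≤-trans (go m≤′m′) (C-mono-suc _ k)

#subsets : ∀ {n} {P : Subset n → Set} → Decidable P → ℕ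
#subsets {n} P? = length (filter P? (allSubsets n))

length-filter-map : ∀ {A X : Set} {P : X → Set} (P? : Decidable P) (f : A → X) (xs : List A) →
                    length (filter P? (map f xs)) ≡ length (filter (P? ∘ f) xs)
length-filter-map P? f []       = refl
length-filter-map P? f (x ∷ xs) with does (P? (f x))
... | true  = cong suc (length-filter-map P? f xs)
... | false = length-filter-map P? f xs

#subsets-suc : ∀ {n} {P : Subset (suc n) → Set} (P? : Decidable P) →
               #subsets P? ≡ #subsets (P? ∘ (inside ∷_)) + #subsets (P? ∘ (outside ∷_))
#subsets-suc {n} P? = begin
  length (filter P? (map (inside ∷_) Ss ++ map (outside ∷_) Ss))
    ≡⟨ cong length (filter-++ P? (map (inside ∷_) Ss) (map (outside ∷_) Ss)) ⟩
  length (filter P? (map (inside ∷_) Ss) ++ filter P? (map (outside ∷_) Ss))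
    ≡⟨ length-++ (filter P? (map (inside ∷_) Ss)) ⟩
  length (filter P? (map (inside ∷_) Ss)) + length (filter P? (map (outside ∷_) Ss))
    ≡⟨ cong₂ _+_ (length-filter-map P? (inside ∷_) Ss) (length-filter-map P? (outside ∷_) Ss) ⟩
  #subsets (P? ∘ (inside ∷_)) + #subsets (P? ∘ (outside ∷_)) ∎
  where
  open ≡-Reasoning
  Ss = allSubsets n

#subsets-none : ∀ {n} {P : Subset n → Set} (P? : Decidable P) → (∀ S → ¬ P S) → #subsets P? ≡ 0
#subsets-none {n} P? none = cong length (filter-none P? (All.universal none (allSubsets n)))

Between : ∀ {n} → ℕ → Subset n → Subset n → Subset n → Set
Between k B A S = ∣ S ∣ ≡ k + ∣ B ∣ × B ⊆ S × S ⊆ A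

between-outside : ∀ {n} {k a} {B A S : Subset n} →
                  Between k (outside ∷ B) (a ∷ A) (outside ∷ S) → Between k B A S
between-outside (size , B⊆S , S⊆A) = size , drop-∷-⊆ B⊆S , drop-∷-⊆ S⊆A

between-missing-head : ∀ {n} {k} {A : Subset (suc n)} {B S : Subset n} →
                       ¬ Between k (inside ∷ B) A (outside ∷ S)
between-missing-head (_ , B⊆S , _) with B⊆S here
... | ()

between-extra-head : ∀ {n} {k} {B : Subset (suc n)} {A S : Subset n} →
                     ¬ Between k B (outside ∷ A) (inside ∷ S)
between-extra-head (_ , _ , S⊆A) with S⊆A here
... | ()

between-inside-inside : ∀ {n} {k a} {B A S : Subset n} →
                        Between k (inside ∷ B) (a ∷ A) (inside ∷ S) → Between k B A S
between-inside-inside {k = k} {B = B} (size , B⊆S , S⊆A) =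
  suc-injective (trans size (+-suc k ∣ B ∣)) , drop-∷-⊆ B⊆S , drop-∷-⊆ S⊆A

between-inside-outside : ∀ {n} {k a} {B A S : Subset n} →
                         Between (suc k) (outside ∷ B) (a ∷ A) (inside ∷ S) → Between k B A S
between-inside-outside (size , B⊆S , S⊆A) = suc-injective size , drop-∷-⊆ B⊆S , drop-∷-⊆ S⊆A

-- A set containing B has at least |B| elements, so it cannot add 0 new ones
-- while also containing a new element.
between-zero-inside : ∀ {n} {a} {B A S : Subset n} →
                      ¬ Between 0 (outside ∷ B) (a ∷ A) (inside ∷ S)
between-zero-inside (size , B⊆S , _) =
  <-irrefl refl (≤-trans (≤-reflexive size) (p⊆q⇒∣p∣≤∣q∣ (drop-∷-⊆ B⊆S)))

between-inside-absent : ∀ {n} {k} {B A : Subset n} {S : Subset (suc n)} →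
                        ¬ Between k (inside ∷ B) (outside ∷ A) S
between-inside-absent (_ , B⊆S , S⊆A) with S⊆A (B⊆S here)
... | ()

-- Counting lemma: at most C(|A ─ B|, k) subsets lie between B and A and have
-- k elements outside B (they are determined by a k-subset of A ─ B).
#between : ∀ {n} k (B A : Subset n) {P : Subset n → Set} (P? : Decidable P) →
           (∀ S → P S → Between k B A S) → #subsets P? ≤ ∣ A ─ B ∣ C k
#between {zero} zero    [] [] P? _ = length-filter P? ([] ∷ [])
#between {zero} (suc k) [] [] P? h =
  ≤-trans (≤-reflexive (#subsets-none P? λ { [] p → no-subset-of-size (proj₁ (h [] p)) })) z≤n
  where
  no-subset-of-size : ¬ (0 ≡ suc (k + 0))
  no-subset-of-size ()
#between {suc n} k (inside ∷ B) (outside ∷ A) P? h =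
  ≤-trans (≤-reflexive (#subsets-none P? λ S p → between-inside-absent (h S p))) z≤n
#between {suc n} k (inside ∷ B) (inside ∷ A) P? h = begin
  #subsets P?                                                   ≡⟨ #subsets-suc P? ⟩
  #subsets (P? ∘ (inside ∷_)) + #subsets (P? ∘ (outside ∷_))
    ≡⟨ cong (#subsets (P? ∘ (inside ∷_)) +_)
            (#subsets-none (P? ∘ (outside ∷_)) λ S p → between-missing-head (h _ p)) ⟩
  #subsets (P? ∘ (inside ∷_)) + 0                               ≡⟨ +-identityʳ _ ⟩
  #subsets (P? ∘ (inside ∷_))
    ≤⟨ #between k B A (P? ∘ (inside ∷_)) (λ S p → between-inside-inside (h _ p)) ⟩
  ∣ A ─ B ∣ C k ∎
  where open ≤-Reasoning
#between {suc n} k (outside ∷ B) (outside ∷ A) P? h = begin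
  #subsets P?                                                   ≡⟨ #subsets-suc P? ⟩
  #subsets (P? ∘ (inside ∷_)) + #subsets (P? ∘ (outside ∷_))
    ≡⟨ cong (_+ #subsets (P? ∘ (outside ∷_)))
            (#subsets-none (P? ∘ (inside ∷_)) λ S p → between-extra-head (h _ p)) ⟩
  #subsets (P? ∘ (outside ∷_))
    ≤⟨ #between k B A (P? ∘ (outside ∷_)) (λ S p → between-outside (h _ p)) ⟩
  ∣ A ─ B ∣ C k ∎
  where open ≤-Reasoning
#between {suc n} zero (outside ∷ B) (inside ∷ A) P? h = begin
  #subsets P?                                                   ≡⟨ #subsets-suc P? ⟩
  #subsets (P? ∘ (inside ∷_)) + #subsets (P? ∘ (outside ∷_))
    ≡⟨ cong (_+ #subsets (P? ∘ (outside ∷_)))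
            (#subsets-none (P? ∘ (inside ∷_)) λ S p → between-zero-inside (h _ p)) ⟩
  #subsets (P? ∘ (outside ∷_))
    ≤⟨ #between zero B A (P? ∘ (outside ∷_)) (λ S p → between-outside (h _ p)) ⟩
  ∣ A ─ B ∣ C zero                                              ≤⟨ C-mono-suc ∣ A ─ B ∣ zero ⟩
  suc ∣ A ─ B ∣ C zero ∎
  where open ≤-Reasoning
#between {suc n} (suc k) (outside ∷ B) (inside ∷ A) P? h = begin
  #subsets P?                                                   ≡⟨ #subsets-suc P? ⟩
  #subsets (P? ∘ (inside ∷_)) + #subsets (P? ∘ (outside ∷_))
    ≤⟨ +-mono-≤ (#between k B A (P? ∘ (inside ∷_)) (λ S p → between-inside-outside (h _ p)))
                (#between (suc k) B A (P? ∘ (outside ∷_)) (λ S p → between-outside (h _ p))) ⟩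
  ∣ A ─ B ∣ C k + ∣ A ─ B ∣ C suc k                             ≡⟨ nCk+nC[k+1]≡[n+1]C[k+1] ∣ A ─ B ∣ k ⟩
  suc ∣ A ─ B ∣ C suc k ∎
  where open ≤-Reasoning

pigeonhole-two : ∀ {A : Set} {a b c p q : A} →
                 (a ≡ p ⊎ a ≡ q) → (b ≡ p ⊎ b ≡ q) → (c ≡ p ⊎ c ≡ q) →
                 (a ≡ b) ⊎ (a ≡ c) ⊎ (b ≡ c)
pigeonhole-two (inj₁ a≡p) (inj₁ b≡p) _          = inj₁ (trans a≡p (sym b≡p))
pigeonhole-two (inj₂ a≡q) (inj₂ b≡q) _          = inj₁ (trans a≡q (sym b≡q))
pigeonhole-two (inj₁ a≡p) (inj₂ _)   (inj₁ c≡p) = inj₂ (inj₁ (trans a≡p (sym c≡p)))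
pigeonhole-two (inj₁ _)   (inj₂ b≡q) (inj₂ c≡q) = inj₂ (inj₂ (trans b≡q (sym c≡q)))
pigeonhole-two (inj₂ _)   (inj₁ b≡p) (inj₁ c≡p) = inj₂ (inj₂ (trans b≡p (sym c≡p)))
pigeonhole-two (inj₂ a≡q) (inj₁ _)   (inj₂ c≡q) = inj₂ (inj₁ (trans a≡q (sym c≡q)))

module Neighbourhoods {n : ℕ} (G : Graph n) where

  adj-sym : ∀ {x y} → Adj G x y → Adj G y x
  adj-sym {x} {y} xy = trans (Graph.sym G y x) xy

  adj-irrefl : ∀ {x y} → Adj G x y → x ≢ y
  adj-irrefl {x} xx refl with trans (sym xx) (irrefl G x)
  ... | ()

  ∈nbhd⁺ : ∀ {x z} → Adj G x z → z ∈ nbhd G x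
  ∈nbhd⁺ {x} = ∈-tabulate⁺ (adj G x)

  ∈nbhd⁻ : ∀ {x z} → z ∈ nbhd G x → Adj G x z
  ∈nbhd⁻ {x} = ∈-tabulate⁻ (adj G x)

  ∈closedNbhd⁺ : ∀ {x z} → z ≡ x ⊎ Adj G x z → z ∈ closedNbhd G x
  ∈closedNbhd⁺ {x} (inj₁ refl) = x∈p∪q⁺ (inj₁ (x∈⁅x⁆ x))
  ∈closedNbhd⁺     (inj₂ xz)   = x∈p∪q⁺ (inj₂ (∈nbhd⁺ xz))

  ∈closedNbhd⁻ : ∀ {x z} → z ∈ closedNbhd G x → z ≡ x ⊎ Adj G x z
  ∈closedNbhd⁻ {x} z∈ with x∈p∪q⁻ ⁅ x ⁆ (nbhd G x) z∈
  ... | inj₁ z∈⁅x⁆ = inj₁ (x∈⁅y⁆⇒x≡y x z∈⁅x⁆)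
  ... | inj₂ z∈Nx  = inj₂ (∈nbhd⁻ z∈Nx)

  ∣closedNbhd∣ : ∀ x → ∣ closedNbhd G x ∣ ≡ suc (deg G x)
  ∣closedNbhd∣ x = begin
    ∣ ⁅ x ⁆ ∪ nbhd G x ∣     ≡⟨ ∣∪∣-disjoint ⁅ x ⁆ (nbhd G x) x∉Nx ⟩
    ∣ ⁅ x ⁆ ∣ + deg G x      ≡⟨ cong (_+ deg G x) (∣⁅x⁆∣≡1 x) ⟩
    suc (deg G x)            ∎
    where
    open ≡-Reasoning
    x∉Nx : ∀ {z} → z ∈ ⁅ x ⁆ → z ∈ nbhd G x → ⊥
    x∉Nx z∈⁅x⁆ z∈Nx = adj-irrefl (∈nbhd⁻ z∈Nx) (sym (x∈⁅y⁆⇒x≡y x z∈⁅x⁆))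

  twins-adjacent : ∀ {x y} → closedNbhd G x ≡ closedNbhd G y → x ≢ y → Adj G x y
  twins-adjacent {x} {y} Nx≡Ny x≢y
    with ∈closedNbhd⁻ (subst (y ∈_) (sym Nx≡Ny) (∈closedNbhd⁺ (inj₁ refl)))
  ... | inj₁ y≡x = contradiction (sym y≡x) x≢y
  ... | inj₂ xy  = xy

  edge-clique : ∀ {x y} → Adj G x y → IsClique G (⁅ x ⁆ ∪ ⁅ y ⁆)
  edge-clique xy u v u∈ v∈ u≢v with ∈pair⁻ u∈ | ∈pair⁻ v∈
  ... | inj₁ refl | inj₁ refl = contradiction refl u≢v
  ... | inj₁ refl | inj₂ refl = xy
  ... | inj₂ refl | inj₁ refl = adj-sym xy
  ... | inj₂ refl | inj₂ refl = contradiction refl u≢v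

  CommonNeighbour : Subset n → Fin n → Set
  CommonNeighbour T z = z ∉ T × (∀ u → u ∈ T → Adj G z u)

  ∈commonNbhd⁺ : ∀ {T z} → CommonNeighbour T z → z ∈ commonNbhd G T
  ∈commonNbhd⁺ {T} = ∈-decide⁺ λ v →
    ¬? (v ∈? T) ×-dec all? (λ u → (u ∈? T) →-dec (adj G v u B.≟ true))

  ∈commonNbhd⁻ : ∀ {T z} → z ∈ commonNbhd G T → CommonNeighbour T z
  ∈commonNbhd⁻ {T} = ∈-decide⁻ λ v →
    ¬? (v ∈? T) ×-dec all? (λ u → (u ∈? T) →-dec (adj G v u B.≟ true))

  span : Subset n → Subset n
  span T = commonNbhd G T ∪ T

  ∣span∣ : ∀ T → ∣ span T ∣ ≡ ∣ commonNbhd G T ∣ + ∣ T ∣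
  ∣span∣ T = ∣∪∣-disjoint (commonNbhd G T) T (λ z∈N z∈T → proj₁ (∈commonNbhd⁻ z∈N) z∈T)

  span⊆closedNbhd : ∀ {T u} → IsClique G T → u ∈ T → span T ⊆ closedNbhd G u
  span⊆closedNbhd {T} {u} T-clique u∈T {z} z∈span with x∈p∪q⁻ (commonNbhd G T) T z∈span
  ... | inj₁ z∈N = ∈closedNbhd⁺ (inj₂ (adj-sym (proj₂ (∈commonNbhd⁻ z∈N) u u∈T)))
  ... | inj₂ z∈T with z FinP.≟ u
  ...   | yes z≡u = ∈closedNbhd⁺ (inj₁ z≡u)
  ...   | no  z≢u = ∈closedNbhd⁺ (inj₂ (T-clique u z u∈T z∈T (z≢u ∘ sym)))

  closedNbhd⊆span : ∀ {S x} → (∀ {s} → s ∈ S → closedNbhd G x ≡ closedNbhd G s) →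
                    closedNbhd G x ⊆ span S
  closedNbhd⊆span {S} twins {z} z∈Nx with z ∈? S
  ... | yes z∈S = x∈p∪q⁺ (inj₂ z∈S)
  ... | no  z∉S = x∈p∪q⁺ (inj₁ (∈commonNbhd⁺ (z∉S , adjacent)))
    where
    adjacent : ∀ u → u ∈ S → Adj G z u
    adjacent u u∈S with ∈closedNbhd⁻ (subst (z ∈_) (twins u∈S) z∈Nx)
    ... | inj₁ z≡u = contradiction (subst (_∈ S) (sym z≡u) u∈S) z∉S
    ... | inj₂ uz  = adj-sym uz

  clique⊆span : ∀ {B S} → B ⊆ S → IsClique G S → S ⊆ span B
  clique⊆span {B} B⊆S S-clique {z} z∈S with z ∈? B
  ... | yes z∈B = x∈p∪q⁺ (inj₂ z∈B)
  ... | no  z∉B = x∈p∪q⁺ (inj₁ (∈commonNbhd⁺ (z∉B , adjacent)))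
    where
    adjacent : ∀ u → u ∈ B → Adj G z u
    adjacent u u∈B = S-clique z u z∈S (B⊆S u∈B) (λ z≡u → z∉B (subst (_∈ B) (sym z≡u) u∈B))

module Tightness (r : ℕ) {n : ℕ} (G : Graph n) (maxDeg : MaxDegreeAtMost G r) where
  open Neighbourhoods G

  ∣closedNbhd∣≤ : ∀ u → ∣ closedNbhd G u ∣ ≤ suc r
  ∣closedNbhd∣≤ u = ≤-trans (≤-reflexive (∣closedNbhd∣ u)) (s≤s (maxDeg u))

  span-bound : ∀ {T u} → IsClique G T → u ∈ T → ∣ span T ∣ ≤ suc r
  span-bound {T} {u} T-clique u∈T =
    ≤-trans (p⊆q⇒∣p∣≤∣q∣ (span⊆closedNbhd T-clique u∈T)) (∣closedNbhd∣≤ u)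

  tight-member : ∀ {T u} → Tight G r T → u ∈ T → deg G u ≡ r × closedNbhd G u ≡ span T
  tight-member {T} {u} (_ , T-clique , T-size) u∈T =
    ≤-antisym (maxDeg u) (≤-pred r+1≤deg+1) ,
    ⊆-antisym (⊆-by-size span⊆Nu Nu≤span) span⊆Nu
    where
    span⊆Nu = span⊆closedNbhd T-clique u∈T
    span≡r+1 : ∣ span T ∣ ≡ suc r
    span≡r+1 = trans (∣span∣ T) T-size
    r+1≤deg+1 : suc r ≤ suc (deg G u)
    r+1≤deg+1 = subst₂ _≤_ span≡r+1 (∣closedNbhd∣ u) (p⊆q⇒∣p∣≤∣q∣ span⊆Nu)
    Nu≤span : ∣ closedNbhd G u ∣ ≤ ∣ span T ∣
    Nu≤span = subst (∣ closedNbhd G u ∣ ≤_) (sym span≡r+1) (∣closedNbhd∣≤ u)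

  tight-twins : ∀ {T u v} → Tight G r T → u ∈ T → v ∈ T → closedNbhd G u ≡ closedNbhd G v
  tight-twins T-tight u∈T v∈T =
    trans (proj₂ (tight-member T-tight u∈T)) (sym (proj₂ (tight-member T-tight v∈T)))

  twins-tight : ∀ {S x} → x ∈ S → deg G x ≡ r →
                (∀ {s} → s ∈ S → closedNbhd G x ≡ closedNbhd G s) → Tight G r S
  twins-tight {S} {x} x∈S deg≡r twins = (x , x∈S) , S-clique , S-size
    where
    S-clique : IsClique G S
    S-clique s s′ s∈S s′∈S = twins-adjacent (trans (sym (twins s∈S)) (twins s′∈S))
    span≡Nx : span S ≡ closedNbhd G x
    span≡Nx = ⊆-antisym (subst (span S ⊆_) (sym (twins x∈S)) (span⊆closedNbhd S-clique x∈S))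
                        (closedNbhd⊆span twins)
    S-size : ∣ commonNbhd G S ∣ + ∣ S ∣ ≡ suc r
    S-size = begin
      ∣ commonNbhd G S ∣ + ∣ S ∣ ≡⟨ sym (∣span∣ S) ⟩
      ∣ span S ∣                 ≡⟨ cong ∣_∣ span≡Nx ⟩
      ∣ closedNbhd G x ∣         ≡⟨ ∣closedNbhd∣ x ⟩
      suc (deg G x)              ≡⟨ cong suc deg≡r ⟩
      suc r                      ∎
      where open ≡-Reasoning

  tight-⊆ : ∀ {S T x} → Tight G r T → S ⊆ T → x ∈ S → Tight G r S
  tight-⊆ T-tight S⊆T x∈S =
    twins-tight x∈S (proj₁ (tight-member T-tight (S⊆T x∈S)))
                (λ s∈S → tight-twins T-tight (S⊆T x∈S) (S⊆T s∈S))

  twins? : ∀ x y → Dec (closedNbhd G x ≡ closedNbhd G y)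
  twins? x y = ≡-dec B._≟_ (closedNbhd G x) (closedNbhd G y)

  twinClass : Fin n → Subset n
  twinClass x = tabulate λ y → does (twins? x y)

  ∈twinClass : ∀ {x y} → y ∈ twinClass x ⇔ (closedNbhd G x ≡ closedNbhd G y)
  ∈twinClass {x} = mk⇔ (∈-decide⁻ (twins? x)) (∈-decide⁺ (twins? x))

  x∈twinClass : ∀ x → x ∈ twinClass x
  x∈twinClass x = Equivalence.from ∈twinClass refl

  twinClass-tight : ∀ {x} → deg G x ≡ r → Tight G r (twinClass x)
  twinClass-tight {x} deg≡r = twins-tight (x∈twinClass x) deg≡r (Equivalence.to ∈twinClass)

  tight⊆twinClass : ∀ {T x} → Tight G r T → x ∈ T → T ⊆ twinClass x
  tight⊆twinClass T-tight x∈T y∈T = Equivalence.from ∈twinClass (tight-twins T-tight x∈T y∈T)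

  twinClass-cluster : ∀ {x} → deg G x ≡ r → Cluster G r (twinClass x)
  twinClass-cluster {x} deg≡r =
    twinClass-tight deg≡r ,
    λ S S-tight class⊆S → ⊆-antisym (tight⊆twinClass S-tight (class⊆S (x∈twinClass x))) class⊆S

  cluster≡twinClass : ∀ {T x} → Cluster G r T → x ∈ T → T ≡ twinClass x
  cluster≡twinClass (T-tight , T-maximal) x∈T =
    sym (T-maximal _ (twinClass-tight (proj₁ (tight-member T-tight x∈T)))
                     (tight⊆twinClass T-tight x∈T))

  commonTight⇒twins : ∀ {x y} → CommonTight G r x y → closedNbhd G x ≡ closedNbhd G y
  commonTight⇒twins (_ , T-tight , x∈T , y∈T) = tight-twins T-tight x∈T y∈T

  twins⇒commonTight : ∀ {x y} → deg G x ≡ r → closedNbhd G x ≡ closedNbhd G y →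
                      CommonTight G r x y
  twins⇒commonTight deg≡r Nx≡Ny =
    _ , twinClass-tight deg≡r , x∈twinClass _ , Equivalence.from ∈twinClass Nx≡Ny

  IsClassOf : Fin n → Subset n → Set
  IsClassOf x T = ∀ y → (y ∈ T) ⇔ (deg G y ≡ r × CommonTight G r x y)

  twinClass-isClass : ∀ {x} → deg G x ≡ r → IsClassOf x (twinClass x)
  twinClass-isClass {x} deg≡r y = mk⇔
    (λ y∈ → proj₁ (tight-member (twinClass-tight deg≡r) y∈) ,
            (_ , twinClass-tight deg≡r , x∈twinClass x , y∈))
    (λ (_ , x~y) → Equivalence.from ∈twinClass (commonTight⇒twins x~y))

  cluster-isClass : ∀ {T} → Cluster G r T → ∃ λ x → deg G x ≡ r × IsClassOf x T
  cluster-isClass T-cluster@(((x , x∈T) , _) , _) =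
    x , deg≡r , subst (IsClassOf x) (sym (cluster≡twinClass T-cluster x∈T)) (twinClass-isClass deg≡r)
    where deg≡r = proj₁ (tight-member (proj₁ T-cluster) x∈T)

  cluster-at-edge : ∀ {T x y} → Cluster G r T → x ∈ T ⊎ y ∈ T →
                    T ≡ twinClass x ⊎ T ≡ twinClass y
  cluster-at-edge T-cluster (inj₁ x∈T) = inj₁ (cluster≡twinClass T-cluster x∈T)
  cluster-at-edge T-cluster (inj₂ y∈T) = inj₂ (cluster≡twinClass T-cluster y∈T)

  tightEdge⇔inCluster : ∀ {x y} → Adj G x y →
    Tight G r (⁅ x ⁆ ∪ ⁅ y ⁆) ⇔ (∃ λ T → Cluster G r T × (⁅ x ⁆ ∪ ⁅ y ⁆) ⊆ T)
  tightEdge⇔inCluster {x} {y} _ = mk⇔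
    (λ e-tight → twinClass x ,
                 twinClass-cluster (proj₁ (tight-member e-tight (x∈pair x y))) ,
                 (λ {z} → tight⊆twinClass e-tight (x∈pair x y)))
    (λ (T , T-cluster , e⊆T) → tight-⊆ (proj₁ T-cluster) e⊆T (x∈pair x y))

  -- A non-tight edge e has |N(e)| + 2 = |span e| < r + 1, so |N(e)| ≤ r - 2.
  nonTightEdge-commonNbhd : ∀ {x y} → Adj G x y → ¬ Tight G r (⁅ x ⁆ ∪ ⁅ y ⁆) →
                            ∣ commonNbhd G (⁅ x ⁆ ∪ ⁅ y ⁆) ∣ ≤ r ∸ 2
  nonTightEdge-commonNbhd {x} {y} xy not-tight =
    m+n≤o⇒m≤o∸n c (≤-pred (≤∧≢⇒< c+2≤r+1 (not-tight ∘ tight)))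
    where
    e = ⁅ x ⁆ ∪ ⁅ y ⁆
    c = ∣ commonNbhd G e ∣
    c+2≡span : c + 2 ≡ ∣ span e ∣
    c+2≡span = trans (cong (c +_) (sym (∣pair∣ (adj-irrefl xy)))) (sym (∣span∣ e))
    c+2≤r+1 : c + 2 ≤ suc r
    c+2≤r+1 = subst (_≤ suc r) (sym c+2≡span) (span-bound (edge-clique xy) (x∈pair x y))
    tight : c + 2 ≡ suc r → Tight G r e
    tight c+2≡r+1 = (x , x∈pair x y) , edge-clique xy ,
                    trans (cong (c +_) (∣pair∣ (adj-irrefl xy))) c+2≡r+1

  -- Every t-clique through a non-tight edge e is e plus t - 2 vertices of
  -- N(e), so the counting lemma bounds k_t(e) by C(|N(e)|, t - 2).
  nonTightEdge-kt : ∀ {x y} → Adj G x y → ¬ Tight G r (⁅ x ⁆ ∪ ⁅ y ⁆) →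
                    ∀ t → 2 ≤ t → kt G t x y ≤ (r ∸ 2) C (t ∸ 2)
  nonTightEdge-kt {x} {y} xy not-tight t 2≤t = begin
    kt G t x y                    ≤⟨ #between (t ∸ 2) e (span e) _ between ⟩
    ∣ span e ─ e ∣ C (t ∸ 2)      ≤⟨ C-mono (t ∸ 2) span─e≤r-2 ⟩
    (r ∸ 2) C (t ∸ 2)             ∎
    where
    open ≤-Reasoning
    e = ⁅ x ⁆ ∪ ⁅ y ⁆
    span─e≤r-2 : ∣ span e ─ e ∣ ≤ r ∸ 2
    span─e≤r-2 = ≤-trans (∣p∪q─q∣≤∣p∣ (commonNbhd G e) e) (nonTightEdge-commonNbhd xy not-tight)
    between : ∀ S → ∣ S ∣ ≡ t × x ∈ S × y ∈ S × IsClique G S → Between (t ∸ 2) e (span e) S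
    between S (size , x∈S , y∈S , S-clique) =
      trans size (trans (sym (m∸n+n≡m 2≤t)) (cong (t ∸ 2 +_) (sym (∣pair∣ (adj-irrefl xy))))) ,
      pair⊆ x∈S y∈S ,
      clique⊆span (pair⊆ x∈S y∈S) S-clique

lemma2p3 : ∀ {n} (r : ℕ) → 1 ≤ r → (G : Graph n) → MaxDegreeAtMost G r →
    -- (1) common tight clique iff equal closed neighbourhoods (degree-r vertices)
    (∀ x y → deg G x ≡ r → deg G y ≡ r →
       (CommonTight G r x y ⇔ (closedNbhd G x ≡ closedNbhd G y)))
    -- (1) the relation is an equivalence relation on degree-r vertices
    × (∀ x → deg G x ≡ r → CommonTight G r x x)
    × (∀ x y → deg G x ≡ r → deg G y ≡ r → CommonTight G r x y → CommonTight G r y x)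
    × (∀ x y z → deg G x ≡ r → deg G y ≡ r → deg G z ≡ r →
         CommonTight G r x y → CommonTight G r y z → CommonTight G r x z)
    -- (1) clusters are pairwise disjoint
    × (∀ T S v → Cluster G r T → Cluster G r S → v ∈ T → v ∈ S → T ≡ S)
    -- (1) every cluster is an equivalence class
    × (∀ T → Cluster G r T → ∃ λ x → deg G x ≡ r ×
         (∀ y → (y ∈ T) ⇔ (deg G y ≡ r × CommonTight G r x y)))
    -- (1) every equivalence class is a cluster
    × (∀ x → deg G x ≡ r → ∃ λ T → Cluster G r T ×
         (∀ y → (y ∈ T) ⇔ (deg G y ≡ r × CommonTight G r x y)))
    -- (2) the endpoints of an edge lie in at most two clusters in total
    × (∀ x y → Adj G x y → ∀ T₁ T₂ T₃ →
         Cluster G r T₁ → Cluster G r T₂ → Cluster G r T₃ →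
         (x ∈ T₁ ⊎ y ∈ T₁) → (x ∈ T₂ ⊎ y ∈ T₂) → (x ∈ T₃ ⊎ y ∈ T₃) →
         (T₁ ≡ T₂) ⊎ (T₁ ≡ T₃) ⊎ (T₂ ≡ T₃))
    -- (3) an edge is tight iff it is contained in a cluster
    × (∀ x y → Adj G x y →
         (Tight G r (⁅ x ⁆ ∪ ⁅ y ⁆) ⇔ (∃ λ T → Cluster G r T × (⁅ x ⁆ ∪ ⁅ y ⁆) ⊆ T)))
    -- (3) bound on k_t for non-tight edges
    × (∀ x y → Adj G x y → (Tight G r (⁅ x ⁆ ∪ ⁅ y ⁆) → ⊥) →
         ∀ t → 2 ≤ t → kt G t x y ≤ (r ∸ 2) C (t ∸ 2))
lemma2p3 r _ G maxDeg =
    (λ x y deg-x _ → mk⇔ commonTight⇒twins (twins⇒commonTight deg-x))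
  , (λ x deg-x → twins⇒commonTight deg-x refl)
  , (λ x y deg-x deg-y x~y → twins⇒commonTight deg-y (sym (commonTight⇒twins x~y)))
  , (λ x y z deg-x _ _ x~y y~z →
       twins⇒commonTight deg-x (trans (commonTight⇒twins x~y) (commonTight⇒twins y~z)))
  , (λ T S v T-cluster S-cluster v∈T v∈S →
       trans (cluster≡twinClass T-cluster v∈T) (sym (cluster≡twinClass S-cluster v∈S)))
  , (λ T → cluster-isClass)
  , (λ x deg-x → twinClass x , twinClass-cluster deg-x , twinClass-isClass deg-x)
  , (λ x y _ T₁ T₂ T₃ c₁ c₂ c₃ m₁ m₂ m₃ →
       pigeonhole-two (cluster-at-edge c₁ m₁) (cluster-at-edge c₂ m₂) (cluster-at-edge c₃ m₃))
  , (λ x y → tightEdge⇔inCluster)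
  , (λ x y → nonTightEdge-kt)
  where open Tightness r G maxDeg
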